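{- Let $\mathcal{G}$ be a finite abstract simplicial complex. Then $$\chi(\mathcal{G})=\sum_{x\in\mathcal{G}}\omega(x)\,\chi(U(x)),$$ where $\omega(x)=(-1)^{\dim x}$, $\chi(A)=\sum_{y\in A}\omega(y)$ for $A\subseteq\mathcal{G}$, and $U(x)=\{y\in\mathcal{G}: x\subseteq y\}$ is the star of $x$.
   Context: A finite abstract simplicial complex $\mathcal{G}$ is a finite set of non-empty finite sets such that every non-empty subset of an element of $\mathcal{G}$ is again in $\mathcal{G}$; $\dim x=|x|-1$. -}

module Defs where

open import Data.Nat using (ℕ; _∸_)
open import Data.Integer using (ℤ; _+_; -_; _^_; +_; 0ℤ; 1ℤ)
open import Data.Fin.Subset using (Subset; _⊆_; Nonempty; ∣_∣)
open import Data.Fin.Subset.Properties using (_⊆?_)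
open import Data.List using (List; foldr; map; filter)
open import Data.List.Membership.Propositional using (_∈_)
open import Data.List.Relation.Unary.Unique.Propositional using (Unique)

record Complex (n : ℕ) : Set where
  field
    faces    : List (Subset n)
    unique   : Unique faces
    nonempty : ∀ {x} → x ∈ faces → Nonempty x
    closed   : ∀ {x y} → x ∈ faces → Nonempty y → y ⊆ x → y ∈ faces
open Complex public

dim : ∀ {n} → Subset n → ℕ
dim x = ∣ x ∣ ∸ 1

ω : ∀ {n} → Subset n → ℤ
ω x = (- 1ℤ) ^ dim x

sumℤ : List ℤ → ℤ
sumℤ = foldr _+_ 0ℤ

χ : ∀ {n} → List (Subset n) → ℤ
χ A = sumℤ (map ω A)

χᴳ : ∀ {n} → Complex n → ℤ
χᴳ G = χ (faces G)

U : ∀ {n} → Complex n → Subset n → List (Subset n)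
U G x = filter (x ⊆?_) (faces G)

-- Expanding χ(U x) and exchanging the two sums turns the right-hand side into
-- Σ_y ω(y) · Σ_{x ⊆ y} ω(x), with x, y ranging over faces.  By closure, the faces
-- below a face y are exactly the nonempty subsets of y, and their alternating
-- count is 1 because Σ_{x ⊆ y} (-1)^|x| = 0 for nonempty y.  What remains is
-- Σ_y ω(y) = χ(G).
module Submission where

open import Defs
open import Algebra.Bundles using (CommutativeMonoid)
open import Algebra.Properties.CommutativeSemigroup using (interchange)
open import Axiom.UniquenessOfIdentityProofs using (UIP; module Decidable⇒UIP)
open import Data.Bool using (true; false; if_then_else_)
import Data.Bool.Properties as Bool
open import Data.Fin using (suc)
open import Data.Fin.Subset using (Subset; _⊆_; Nonempty; ∣_∣; inside; outside)
open import Data.Fin.Subset.Properties using (_⊆?_; ⊆-refl; nonempty?; drop-∷-⊆; out⊆; s⊆s)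
open import Data.Integer using (ℤ; _+_; _*_; -_; _^_; 0ℤ; 1ℤ)
open import Data.Integer.Properties
  using (+-0-commutativeMonoid; +-commutativeSemigroup; +-identityˡ; +-identityʳ; +-inverseˡ
        ; +-assoc; +-comm; *-zeroʳ; *-zeroˡ; *-distribˡ-+; *-distribʳ-+; *-identityˡ; -1*i≡-i)
open import Data.List using (List; []; _∷_; _++_; map; filter)
open import Data.List.Membership.Propositional using (_∈_)
open import Data.List.Membership.Propositional.Properties
  using (∈-map⁺; ∈-map⁻; ∈-++⁺ˡ; ∈-++⁺ʳ; ∈-++⁻; ∈-filter⁺; ∈-filter⁻)
import Data.List.Membership.Setoid.Properties as SetoidMembership
open import Data.List.Relation.Binary.BagAndSetEquality using (∼bag⇒↭)
open import Data.List.Relation.Binary.Permutation.Propositional using (_↭_; ↭⇒↭ₛ)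
import Data.List.Relation.Binary.Permutation.Propositional.Properties as Perm
open import Data.List.Relation.Binary.Permutation.Setoid.Properties using (foldr-commMonoid)
open import Data.List.Relation.Unary.All using ([])
open import Data.List.Relation.Unary.AllPairs using ([]; _∷_)
open import Data.List.Relation.Unary.Any using (here; there)
open import Data.List.Relation.Unary.Unique.Propositional using (Unique)
import Data.List.Relation.Unary.Unique.Propositional.Properties as Unique
open import Data.Empty using (⊥)
open import Data.Nat using (ℕ; suc)
open import Data.Product using (_,_)
open import Data.Sum using (inj₁; inj₂)
open import Data.Vec using ([]; _∷_)
import Data.Vec.Base as Vec
open import Data.Vec.Properties using (∷-injectiveʳ; ≡-dec)
open import Function.Bundles using (_⇔_; mk⇔; mk↔ₛ′; Equivalence)
open import Relation.Binary.PropositionalEquality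
  using (_≡_; refl; sym; trans; cong; cong₂; setoid; module ≡-Reasoning)
open import Relation.Nullary using (Dec; does)
open import Relation.Nullary.Decidable using (does-⇔)
open import Relation.Unary using (Decidable; Irrelevant)

∑ : {A : Set} → List A → (A → ℤ) → ℤ
∑ xs f = sumℤ (map f xs)

∑-cong : {A : Set} (xs : List A) {f g : A → ℤ} → (∀ {x} → x ∈ xs → f x ≡ g x) → ∑ xs f ≡ ∑ xs g
∑-cong []       f≗g = refl
∑-cong (x ∷ xs) f≗g = cong₂ _+_ (f≗g (here refl)) (∑-cong xs (λ x∈xs → f≗g (there x∈xs)))

∑-++ : {A : Set} (xs ys : List A) (f : A → ℤ) → ∑ (xs ++ ys) f ≡ ∑ xs f + ∑ ys f
∑-++ []       ys f = sym (+-identityˡ _)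
∑-++ (x ∷ xs) ys f = trans (cong (f x +_) (∑-++ xs ys f)) (sym (+-assoc (f x) _ _))

∑-map : {A B : Set} (xs : List A) (g : A → B) (f : B → ℤ) → ∑ (map g xs) f ≡ ∑ xs (λ x → f (g x))
∑-map []       g f = refl
∑-map (x ∷ xs) g f = cong (f (g x) +_) (∑-map xs g f)

∑-zero : {A : Set} (xs : List A) → ∑ xs (λ _ → 0ℤ) ≡ 0ℤ
∑-zero []       = refl
∑-zero (x ∷ xs) = trans (+-identityˡ _) (∑-zero xs)

∑-+ : {A : Set} (xs : List A) (f g : A → ℤ) → ∑ xs (λ x → f x + g x) ≡ ∑ xs f + ∑ xs g
∑-+ []       f g = refl
∑-+ (x ∷ xs) f g =
  trans (cong (f x + g x +_) (∑-+ xs f g)) (interchange +-commutativeSemigroup (f x) (g x) _ _)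

∑-*ˡ : {A : Set} (c : ℤ) (xs : List A) (f : A → ℤ) → c * ∑ xs f ≡ ∑ xs (λ x → c * f x)
∑-*ˡ c []       f = *-zeroʳ c
∑-*ˡ c (x ∷ xs) f = trans (*-distribˡ-+ c (f x) _) (cong (c * f x +_) (∑-*ˡ c xs f))

∑-*ʳ : {A : Set} (c : ℤ) (xs : List A) (f : A → ℤ) → ∑ xs f * c ≡ ∑ xs (λ x → f x * c)
∑-*ʳ c []       f = *-zeroˡ c
∑-*ʳ c (x ∷ xs) f = trans (*-distribʳ-+ c (f x) _) (cong (f x * c +_) (∑-*ʳ c xs f))

∑-swap : {A B : Set} (xs : List A) (ys : List B) (g : A → B → ℤ) →
         ∑ xs (λ x → ∑ ys (g x)) ≡ ∑ ys (λ y → ∑ xs (λ x → g x y))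
∑-swap []       ys g = sym (∑-zero ys)
∑-swap (x ∷ xs) ys g =
  trans (cong (∑ ys (g x) +_) (∑-swap xs ys g)) (sym (∑-+ ys (g x) (λ y → ∑ xs (λ x → g x y))))

∑-filter : {A : Set} {P : A → Set} (P? : Decidable P) (xs : List A) (f : A → ℤ) →
           ∑ (filter P? xs) f ≡ ∑ xs (λ x → if does (P? x) then f x else 0ℤ)
∑-filter P? []       f = refl
∑-filter P? (x ∷ xs) f with does (P? x)
... | true  = cong (f x +_) (∑-filter P? xs f)
... | false = trans (∑-filter P? xs f) (sym (+-identityˡ _))

∑-filter-swap : {A B : Set} {R : A → B → Set} (R? : ∀ x y → Dec (R x y))
                (xs : List A) (ys : List B) (g : A → B → ℤ) →
                ∑ xs (λ x → ∑ (filter (R? x) ys) (g x)) ≡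
                ∑ ys (λ y → ∑ (filter (λ x → R? x y) xs) (λ x → g x y))
∑-filter-swap R? xs ys g = begin
  ∑ xs (λ x → ∑ (filter (R? x) ys) (g x))
    ≡⟨ ∑-cong xs (λ {x} _ → ∑-filter (R? x) ys (g x)) ⟩
  ∑ xs (λ x → ∑ ys (λ y → if does (R? x y) then g x y else 0ℤ))
    ≡⟨ ∑-swap xs ys _ ⟩
  ∑ ys (λ y → ∑ xs (λ x → if does (R? x y) then g x y else 0ℤ))
    ≡⟨ ∑-cong ys (λ {y} _ → ∑-filter (λ x → R? x y) xs (λ x → g x y)) ⟨
  ∑ ys (λ y → ∑ (filter (λ x → R? x y) xs) (λ x → g x y)) ∎
  where open ≡-Reasoning

∑-↭ : {A : Set} {xs ys : List A} (f : A → ℤ) → xs ↭ ys → ∑ xs f ≡ ∑ ys f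
∑-↭ f xs↭ys = foldr-commMonoid ℤ+.setoid ℤ+.isCommutativeMonoid (↭⇒↭ₛ (Perm.map⁺ f xs↭ys))
  where module ℤ+ = CommutativeMonoid +-0-commutativeMonoid

-- Under UIP, membership in a duplicate-free list is proof-irrelevant,
-- so having the same members already makes xs and ys bag-equal.
unique∧sameMembers⇒↭ : {A : Set} → UIP A → {xs ys : List A} → Unique xs → Unique ys →
                        (∀ {x} → x ∈ xs ⇔ x ∈ ys) → xs ↭ ys
unique∧sameMembers⇒↭ {A} uip uxs uys same =
  ∼bag⇒↭ (mk↔ₛ′ (Equivalence.to same) (Equivalence.from same)
                 (λ _ → irrelevant uys _ _) (λ _ → irrelevant uxs _ _))
  where
  irrelevant : ∀ {zs} → Unique zs → Irrelevant (_∈ zs)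
  irrelevant = SetoidMembership.unique⇒irrelevant (setoid A) uip

subsetsOf : ∀ {n} → Subset n → List (Subset n)
subsetsOf []            = [] ∷ []
subsetsOf (outside ∷ y) = map (outside ∷_) (subsetsOf y)
subsetsOf (inside ∷ y)  = map (inside ∷_) (subsetsOf y) ++ map (outside ∷_) (subsetsOf y)

∈-subsetsOf⁺ : ∀ {n} {x y : Subset n} → x ⊆ y → x ∈ subsetsOf y
∈-subsetsOf⁺ {x = []}          {[]}          _   = here refl
∈-subsetsOf⁺ {x = outside ∷ x} {outside ∷ y} x⊆y = ∈-map⁺ _ (∈-subsetsOf⁺ (drop-∷-⊆ x⊆y))
∈-subsetsOf⁺ {x = inside ∷ x}  {outside ∷ y} x⊆y with () ← x⊆y Vec.here
∈-subsetsOf⁺ {x = inside ∷ x}  {inside ∷ y}  x⊆y = ∈-++⁺ˡ (∈-map⁺ _ (∈-subsetsOf⁺ (drop-∷-⊆ x⊆y)))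
∈-subsetsOf⁺ {x = outside ∷ x} {inside ∷ y}  x⊆y =
  ∈-++⁺ʳ (map (inside ∷_) (subsetsOf y)) (∈-map⁺ _ (∈-subsetsOf⁺ (drop-∷-⊆ x⊆y)))

∈-subsetsOf⁻ : ∀ {n} {x : Subset n} (y : Subset n) → x ∈ subsetsOf y → x ⊆ y
∈-subsetsOf⁻ []            (here refl) = ⊆-refl
∈-subsetsOf⁻ (outside ∷ y) x∈
  with x , x∈ , refl ← ∈-map⁻ _ x∈ = out⊆ (∈-subsetsOf⁻ y x∈)
∈-subsetsOf⁻ (inside ∷ y)  x∈ with ∈-++⁻ (map (inside ∷_) (subsetsOf y)) x∈
... | inj₁ x∈ˡ with x , x∈ , refl ← ∈-map⁻ _ x∈ˡ = s⊆s (∈-subsetsOf⁻ y x∈)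
... | inj₂ x∈ʳ with x , x∈ , refl ← ∈-map⁻ _ x∈ʳ = out⊆ (∈-subsetsOf⁻ y x∈)

subsetsOf-unique : ∀ {n} (y : Subset n) → Unique (subsetsOf y)
subsetsOf-unique []            = [] ∷ []
subsetsOf-unique (outside ∷ y) = Unique.map⁺ ∷-injectiveʳ (subsetsOf-unique y)
subsetsOf-unique (inside ∷ y)  =
  Unique.++⁺ (Unique.map⁺ ∷-injectiveʳ (subsetsOf-unique y))
             (Unique.map⁺ ∷-injectiveʳ (subsetsOf-unique y))
             (λ (v∈ˡ , v∈ʳ) → inside≢outside v∈ˡ v∈ʳ)
  where
  inside≢outside : ∀ {v} → v ∈ map (inside ∷_) (subsetsOf y) →
                   v ∈ map (outside ∷_) (subsetsOf y) → ⊥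
  inside≢outside v∈ˡ v∈ʳ with _ , _ , refl ← ∈-map⁻ _ v∈ˡ | _ , _ , () ← ∈-map⁻ _ v∈ʳ

∑-subsetsOf-inside : ∀ {n} (y : Subset n) (f : Subset (suc n) → ℤ) →
  ∑ (subsetsOf (inside ∷ y)) f ≡
  ∑ (subsetsOf y) (λ x → f (inside ∷ x)) + ∑ (subsetsOf y) (λ x → f (outside ∷ x))
∑-subsetsOf-inside y f = trans (∑-++ (map (inside ∷_) (subsetsOf y)) _ f)
  (cong₂ _+_ (∑-map (subsetsOf y) (inside ∷_) f) (∑-map (subsetsOf y) (outside ∷_) f))

sign : ∀ {n} → Subset n → ℤ
sign x = (- 1ℤ) ^ ∣ x ∣

-- ω⁺ x + sign x is 1 for x = ∅ and 0 otherwise.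
ω⁺ : ∀ {n} → Subset n → ℤ
ω⁺ x = if does (nonempty? x) then ω x else 0ℤ

nonempty-outside : ∀ {n} {x : Subset n} → Nonempty (outside ∷ x) ⇔ Nonempty x
nonempty-outside = mk⇔ (λ { (suc i , Vec.there i∈x) → i , i∈x }) (λ (i , i∈x) → suc i , Vec.there i∈x)

∑sign-subsetsOf-inside : ∀ {n} (y : Subset n) → ∑ (subsetsOf (inside ∷ y)) sign ≡ 0ℤ
∑sign-subsetsOf-inside y = begin
  ∑ (subsetsOf (inside ∷ y)) sign
    ≡⟨ ∑-subsetsOf-inside y sign ⟩
  ∑ (subsetsOf y) (λ x → - 1ℤ * sign x) + ∑ (subsetsOf y) sign
    ≡⟨ cong (_+ ∑ (subsetsOf y) sign) (∑-*ˡ (- 1ℤ) (subsetsOf y) sign) ⟨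
  - 1ℤ * ∑ (subsetsOf y) sign + ∑ (subsetsOf y) sign
    ≡⟨ cong (_+ ∑ (subsetsOf y) sign) (-1*i≡-i (∑ (subsetsOf y) sign)) ⟩
  - ∑ (subsetsOf y) sign + ∑ (subsetsOf y) sign
    ≡⟨ +-inverseˡ (∑ (subsetsOf y) sign) ⟩
  0ℤ ∎
  where open ≡-Reasoning

∑sign-subsetsOf-nonempty : ∀ {n} (y : Subset n) → Nonempty y → ∑ (subsetsOf y) sign ≡ 0ℤ
∑sign-subsetsOf-nonempty (inside ∷ y)  _    = ∑sign-subsetsOf-inside y
∑sign-subsetsOf-nonempty (outside ∷ y) y≠∅ =
  trans (∑-map (subsetsOf y) (outside ∷_) sign)
        (∑sign-subsetsOf-nonempty y (Equivalence.to nonempty-outside y≠∅))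

ω⁺-outside : ∀ {n} (x : Subset n) → ω⁺ (outside ∷ x) ≡ ω⁺ x
ω⁺-outside x =
  cong (if_then ω x else 0ℤ) (does-⇔ nonempty-outside (nonempty? (outside ∷ x)) (nonempty? x))

∑ω⁺-subsetsOf-outside : ∀ {n} (y : Subset n) →
  ∑ (subsetsOf y) (λ x → ω⁺ (outside ∷ x)) ≡ ∑ (subsetsOf y) ω⁺
∑ω⁺-subsetsOf-outside y = ∑-cong (subsetsOf y) (λ {x} _ → ω⁺-outside x)

∑ω⁺+∑sign-subsetsOf : ∀ {n} (y : Subset n) → ∑ (subsetsOf y) ω⁺ + ∑ (subsetsOf y) sign ≡ 1ℤ
∑ω⁺+∑sign-subsetsOf [] = refl
∑ω⁺+∑sign-subsetsOf (outside ∷ y) =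
  trans (cong₂ _+_ (trans (∑-map (subsetsOf y) (outside ∷_) ω⁺) (∑ω⁺-subsetsOf-outside y))
                   (∑-map (subsetsOf y) (outside ∷_) sign))
        (∑ω⁺+∑sign-subsetsOf y)
∑ω⁺+∑sign-subsetsOf (inside ∷ y) = begin
  ∑ (subsetsOf (inside ∷ y)) ω⁺ + ∑ (subsetsOf (inside ∷ y)) sign
    ≡⟨ cong₂ _+_ (∑-subsetsOf-inside y ω⁺) (∑sign-subsetsOf-inside y) ⟩
  (∑ (subsetsOf y) sign + ∑ (subsetsOf y) (λ x → ω⁺ (outside ∷ x))) + 0ℤ
    ≡⟨ +-identityʳ _ ⟩
  ∑ (subsetsOf y) sign + ∑ (subsetsOf y) (λ x → ω⁺ (outside ∷ x))
    ≡⟨ cong (∑ (subsetsOf y) sign +_) (∑ω⁺-subsetsOf-outside y) ⟩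
  ∑ (subsetsOf y) sign + ∑ (subsetsOf y) ω⁺
    ≡⟨ +-comm (∑ (subsetsOf y) sign) _ ⟩
  ∑ (subsetsOf y) ω⁺ + ∑ (subsetsOf y) sign
    ≡⟨ ∑ω⁺+∑sign-subsetsOf y ⟩
  1ℤ ∎
  where open ≡-Reasoning

χ-nonemptySubsetsOf : ∀ {n} (y : Subset n) → Nonempty y → χ (filter nonempty? (subsetsOf y)) ≡ 1ℤ
χ-nonemptySubsetsOf y y≠∅ = begin
  χ (filter nonempty? (subsetsOf y))
    ≡⟨ ∑-filter nonempty? (subsetsOf y) ω ⟩
  ∑ (subsetsOf y) ω⁺
    ≡⟨ +-identityʳ _ ⟨
  ∑ (subsetsOf y) ω⁺ + 0ℤ
    ≡⟨ cong (∑ (subsetsOf y) ω⁺ +_) (∑sign-subsetsOf-nonempty y y≠∅) ⟨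
  ∑ (subsetsOf y) ω⁺ + ∑ (subsetsOf y) sign
    ≡⟨ ∑ω⁺+∑sign-subsetsOf y ⟩
  1ℤ ∎
  where open ≡-Reasoning

χ-facesBelow : ∀ {n} (G : Complex n) {y : Subset n} → y ∈ faces G →
               χ (filter (_⊆? y) (faces G)) ≡ 1ℤ
χ-facesBelow G {y} y∈G = trans
  (∑-↭ ω (unique∧sameMembers⇒↭ (Decidable⇒UIP.≡-irrelevant (≡-dec Bool._≟_))
            (Unique.filter⁺ (_⊆? y) (unique G))
            (Unique.filter⁺ nonempty? (subsetsOf-unique y))
            (mk⇔ facesBelow⇒nonemptySubset nonemptySubset⇒facesBelow)))
  (χ-nonemptySubsetsOf y (nonempty G y∈G))
  where
  facesBelow⇒nonemptySubset : ∀ {x} → x ∈ filter (_⊆? y) (faces G) →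
                              x ∈ filter nonempty? (subsetsOf y)
  facesBelow⇒nonemptySubset x∈ with x∈G , x⊆y ← ∈-filter⁻ (_⊆? y) x∈ =
    ∈-filter⁺ nonempty? (∈-subsetsOf⁺ x⊆y) (nonempty G x∈G)
  nonemptySubset⇒facesBelow : ∀ {x} → x ∈ filter nonempty? (subsetsOf y) →
                              x ∈ filter (_⊆? y) (faces G)
  nonemptySubset⇒facesBelow x∈ with x∈y , x≠∅ ← ∈-filter⁻ nonempty? x∈ =
    ∈-filter⁺ (_⊆? y) (closed G y∈G x≠∅ (∈-subsetsOf⁻ y x∈y)) (∈-subsetsOf⁻ y x∈y)

mainTheorem9 : (n : ℕ) (G : Complex n) →
    χᴳ G ≡ sumℤ (map (λ x → ω x * χ (U G x)) (faces G))
mainTheorem9 n G = sym (begin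
  ∑ F (λ x → ω x * χ (U G x))
    ≡⟨ ∑-cong F (λ {x} _ → ∑-*ˡ (ω x) (U G x) ω) ⟩
  ∑ F (λ x → ∑ (filter (x ⊆?_) F) (λ y → ω x * ω y))
    ≡⟨ ∑-filter-swap _⊆?_ F F (λ x y → ω x * ω y) ⟩
  ∑ F (λ y → ∑ (filter (_⊆? y) F) (λ x → ω x * ω y))
    ≡⟨ ∑-cong F (λ {y} _ → ∑-*ʳ (ω y) (filter (_⊆? y) F) ω) ⟨
  ∑ F (λ y → χ (filter (_⊆? y) F) * ω y)
    ≡⟨ ∑-cong F (λ {y} y∈G →
         trans (cong (_* ω y) (χ-facesBelow G y∈G)) (*-identityˡ (ω y))) ⟩
  ∑ F ω ∎)
  where
  open ≡-Reasoning
  F : List (Subset n)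
  F = faces G
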